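{- Let $q\ge 19$ be an odd prime. For an integer $\overline{H}$, let $\mathcal{P}_{\overline{H}}=\{(0,1,0)\}\cup\{(1,i,i^2): i=0,1,\dots,\overline{H}\}$, and let $\overline{H}_q$ be the smallest integer $\overline{H}$ such that every point $(1,a,b)$ with $a,b\in F_q$, $b\neq a^2$, lies on a bisecant of $\mathcal{P}_{\overline{H}}$. Assume $\overline{H}_q\le (q-1)/2$ and let $H$ be an integer with $\max\{\overline{H}_q,\lfloor (q-1)/3\rfloor\}\le H\le (q-1)/2$. Let $\mathcal{K}_H=\{(1,i,i^2): i=0,\dots,H\}\cup\{(0,1,0),(0,1,b_H)\}$ where $b_H=2H+1$ if $H=\lfloor (q-1)/3\rfloor$ and $b_H=2H$ otherwise. Then $\mathcal{K}_H$ is a complete arc in $PG(2,q)$.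
   Context: Points of $PG(2,q)$ are in homogeneous coordinates $(x_0,x_1,x_2)$; integers are read in $F_q$. A bisecant of a point set is a line through two of its distinct points. An arc is a set of points no three collinear; it is complete if it is not contained in a larger arc. -}

module Defs where

open import Data.Nat as ℕ using (ℕ; _≤_; _<_; _∸_; _/_)
open import Data.Integer as ℤ using (ℤ; +_; _-_)
open import Data.Integer.Divisibility using () renaming (_∣_ to _∣ℤ_)
open import Data.List using (List; _∷_; map; upTo)
open import Data.List.Membership.Propositional using (_∈_)
open import Data.Product using (_×_; _,_; Σ; ∃; ∃-syntax)
open import Relation.Nullary using (¬_; yes; no)
open import Relation.Binary.PropositionalEquality using (_≡_)

-- Elements of F_q are represented by integers, read modulo q.
-- Congruence modulo q (equality in F_q).
infix 4 _≈[_]_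
_≈[_]_ : ℤ → ℕ → ℤ → Set
a ≈[ q ] b = (+ q) ∣ℤ (a - b)

Triple : Set
Triple = ℤ × ℤ × ℤ

NonZero3 : ℕ → Triple → Set
NonZero3 q (x , y , z) = ¬ ((x ≈[ q ] + 0) × (y ≈[ q ] + 0) × (z ≈[ q ] + 0))

SamePt : ℕ → Triple → Triple → Set
SamePt q (x , y , z) (x' , y' , z') =
  ∃[ c ] (¬ (c ≈[ q ] + 0)) × (x' ≈[ q ] (c ℤ.* x)) × (y' ≈[ q ] (c ℤ.* y)) × (z' ≈[ q ] (c ℤ.* z))

Incident : ℕ → Triple → Triple → Set
Incident q (a , b , c) (x , y , z) = ((a ℤ.* x) ℤ.+ (b ℤ.* y) ℤ.+ (c ℤ.* z)) ≈[ q ] + 0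

Collinear : ℕ → Triple → Triple → Triple → Set
Collinear q p r s = ∃[ l ] NonZero3 q l × Incident q l p × Incident q l r × Incident q l s

-- Finite point sets are given as lists of coordinate vectors; membership is up to
-- projective equality.
InSet : ℕ → List Triple → Triple → Set
InSet q S p = ∃[ r ] (r ∈ S) × SamePt q r p

IsArc : ℕ → List Triple → Set
IsArc q S =
  (∀ p → p ∈ S → NonZero3 q p) ×
  (∀ x y z → x ∈ S → y ∈ S → z ∈ S →
     ¬ SamePt q x y → ¬ SamePt q x z → ¬ SamePt q y z → ¬ Collinear q x y z)

IsCompleteArc : ℕ → List Triple → Set
IsCompleteArc q S =
  IsArc q S ×
  (∀ (T : List Triple) → IsArc q T → (∀ p → InSet q S p → InSet q T p) →
     ∀ p → InSet q T p → InSet q S p)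

OnBisecant : ℕ → List Triple → Triple → Set
OnBisecant q S p =
  ∃[ x ] ∃[ y ] (x ∈ S) × (y ∈ S) × (¬ SamePt q x y) × Collinear q x y p

conicPts : ℕ → List Triple
conicPts n = map (λ i → (+ 1 , + i , + (i ℕ.* i))) (upTo (ℕ.suc n))

𝒫 : ℕ → List Triple
𝒫 Hb = (+ 0 , + 1 , + 0) ∷ conicPts Hb

Covers : ℕ → ℕ → Set
Covers q Hb = ∀ (a b : ℤ) → ¬ (b ≈[ q ] (a ℤ.* a)) → OnBisecant q (𝒫 Hb) (+ 1 , a , b)

IsHbarq : ℕ → ℕ → Set
IsHbarq q Hq = Covers q Hq × (∀ h → h < Hq → ¬ Covers q h)

bH : ℕ → ℕ → ℕ
bH q H with H ℕ.≟ ((q ∸ 1) / 3)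
... | yes _ = 2 ℕ.* H ℕ.+ 1
... | no  _ = 2 ℕ.* H

𝒦 : ℕ → ℕ → List Triple
𝒦 q H = (+ 0 , + 1 , + 0) ∷ (+ 0 , + 1 , + bH q H) ∷ conicPts H

module Submission where

-- Write A = (0,1,0), B = (0,1,b) with b = b_H, and C i = (1,i,i²), so 𝒦_H = {A,B} ∪ {C i : i ≤ H}.
--
-- Arc: a line through (0,1,w) has "slope" w (l1 + w l2 = 0), a line through C i ≠ C j has
-- slope i + j, and a line with two slopes meeting the conic is zero.  As
-- 0 < i + j < 2H ≤ b < q for distinct i, j ≤ H, no three points of 𝒦_H are collinear.
-- Completeness: a point r of an arc T ⊇ 𝒦_H with x0 = 0 is A or B.  Otherwise r = (1,a,c);
-- if c ≠ a², r is on a bisecant of 𝒫_{H̄_q} ⊆ 𝒦_H; if c = a², r = C j with j < q, and for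
-- j > H it is on the bisecant through B, C (b - j) (j ≤ b) or through A, C (q - j) (j > b).

open import Defs
open import Data.Nat using (ℕ; _≤_; _∸_; _/_; _⊔_)
open import Data.Nat.Primality using (Prime)
open import Data.Nat.Divisibility using (_∣_)
open import Relation.Nullary using (¬_)

import Data.Nat as Nat
open Nat using (zero; suc; _<_; z≤n; s≤s)
import Data.Nat.Properties as ℕP
import Data.Nat.Divisibility as ℕD
import Data.Nat.DivMod as ℕDM
import Data.Nat.Primality as Primality
import Data.Nat.Coprimality as Coprimality
open import Data.Nat.GCD using (module Bézout)
import Data.Nat.Tactic.RingSolver as ℕSolver
open import Data.Integer using (ℤ; +_; _+_; _*_; _-_; -_; ∣_∣)
import Data.Integer as Int
import Data.Integer.Properties as ℤP
import Data.Integer.Divisibility.Signed as ℤS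
import Data.Integer.DivMod as ℤDM
open import Data.Integer.Tactic.RingSolver using (solve-∀)
open import Data.List using (List; _∷_)
open import Data.List.Membership.Propositional using (_∈_)
open import Data.List.Relation.Unary.Any using (here; there)
import Data.List.Membership.Propositional.Properties as ∈P
open import Data.Product using (_×_; _,_; ∃-syntax; proj₁; proj₂)
open import Data.Sum using (_⊎_; inj₁; inj₂; fromInj₂)
import Data.Sum as Sum
open import Data.Empty using (⊥-elim)
open import Function using (_∘_)
open import Relation.Nullary using (Dec; yes; no; contradiction)
open import Relation.Nullary.Decidable using (map′)
open import Relation.Binary using (tri<; tri≈; tri>)
open import Relation.Binary.PropositionalEquality
  using (_≡_; _≢_; refl; sym; trans; cong; subst)

-- (1) Arithmetic in F_q

module PrimeField (q : ℕ) (q-prime : Prime q) where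

  instance
    q-nonZero : Nat.NonZero q
    q-nonZero = Primality.prime⇒nonZero q-prime

  -- e is zero in F_q.  Signed divisibility is a record indexed by e, so e can be
  -- recovered from a proof by unification.
  Null : ℤ → Set
  Null e = + q ℤS.∣ e

  null-0 : Null (+ 0)
  null-0 = ℤS.divides (+ 0) refl

  null-q : Null (+ q)
  null-q = ℤS.∣-refl

  equal⇒null : ∀ {a b} → a ≡ b → Null (a - b)
  equal⇒null {a} refl = subst Null (sym (ℤP.+-inverseʳ a)) null-0

  null⇒≈0 : ∀ {e} → Null e → e ≈[ q ] + 0
  null⇒≈0 {e} n = ℤS.∣⇒∣ᵤ (subst Null (sym (ℤP.+-identityʳ e)) n)

  ≈0⇒null : ∀ e → e ≈[ q ] + 0 → Null e
  ≈0⇒null e n = subst Null (ℤP.+-identityʳ e) (ℤS.∣ᵤ⇒∣ n)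

  comb₁ : ∀ {a e} x → Null a → e ≡ x * a → Null e
  comb₁ x na eq = subst Null (sym eq) (ℤS.∣n⇒∣m*n x na)

  comb₂ : ∀ {a b e} x y → Null a → Null b → e ≡ x * a + y * b → Null e
  comb₂ x y na nb eq =
    subst Null (sym eq) (ℤS.∣m∣n⇒∣m+n (ℤS.∣n⇒∣m*n x na) (ℤS.∣n⇒∣m*n y nb))

  comb₃ : ∀ {a b c e} x y z → Null a → Null b → Null c → e ≡ x * a + y * b + z * c → Null e
  comb₃ x y z na nb nc eq =
    subst Null (sym eq) (ℤS.∣m∣n⇒∣m+n (comb₂ x y na nb refl) (ℤS.∣n⇒∣m*n z nc))

  comb₄ : ∀ {a b c d e} x y z w → Null a → Null b → Null c → Null d →
    e ≡ x * a + y * b + z * c + w * d → Null e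
  comb₄ x y z w na nb nc nd eq =
    subst Null (sym eq) (ℤS.∣m∣n⇒∣m+n (comb₃ x y z na nb nc refl) (ℤS.∣n⇒∣m*n w nd))

  null-product : ∀ a b → Null (a * b) → Null a ⊎ Null b
  null-product a b n = Sum.map ℤS.∣ᵤ⇒∣ ℤS.∣ᵤ⇒∣
    (Primality.euclidsLemma ∣ a ∣ ∣ b ∣ q-prime (subst (q ℕD.∣_) (ℤP.abs-* a b) (ℤS.∣⇒∣ᵤ n)))

  null? : ∀ e → Dec (Null e)
  null? e = map′ ℤS.∣ᵤ⇒∣ ℤS.∣⇒∣ᵤ (q ℕD.∣? ∣ e ∣)

  -- Distinct residues i, j < q are distinct in F_q: 0 < |i - j| < q.
  distinct : ∀ {i j} → i < q → j < q → i ≢ j → ¬ Null (+ i - + j)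
  distinct {i} {j} i<q j<q i≢j n with ∣ + i - + j ∣ Nat.≟ 0
  ... | yes e = i≢j (ℤP.+-injective (ℤP.i-j≡0⇒i≡j (+ i) (+ j) (ℤP.∣i∣≡0⇒i≡0 e)))
  ... | no ne = ℕP.<⇒≱ below-q (ℕD.∣⇒≤ {{Nat.≢-nonZero ne}} (ℤS.∣⇒∣ᵤ n))
    where
    below-q : ∣ + i - + j ∣ < q
    below-q = ℕP.≤-<-trans
      (subst (Nat._≤ i ⊔ j) (cong ∣_∣ (sym (ℤP.m-n≡m⊖n i j))) (ℤP.∣m⊝n∣≤m⊔n i j))
      (ℕP.⊔-lub i<q j<q)

  1<q : 1 < q
  1<q = Nat.nonTrivial⇒n>1 q {{Primality.prime⇒nonTrivial q-prime}}

  0<q : 0 < q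
  0<q = ℕP.<-trans (s≤s z≤n) 1<q

  one≢0 : ¬ Null (+ 1)
  one≢0 = distinct 1<q 0<q (λ ())

  residue : ∀ a → ∃[ j ] j < q × Null (a - + j)
  residue a = a Int.%ℕ q , ℤDM.n%ℕd<d a q , ℤS.divides (a Int./ℕ q) a-r≡
    where
    cancel : ∀ r k → (r + k) - r ≡ k
    cancel = solve-∀
    a-r≡ : a - + (a Int.%ℕ q) ≡ (a Int./ℕ q) * + q
    a-r≡ = trans (cong (_- + (a Int.%ℕ q)) (ℤDM.a≡a%ℕn+[a/ℕn]*n a q))
                 (cancel (+ (a Int.%ℕ q)) ((a Int./ℕ q) * + q))

  -- Non-zero elements of F_q are invertible: Bézout for the coprime pair (q, j),
  -- where j is the residue of a.
  inverse : ∀ a → ¬ Null a → ∃[ u ] Null (u * a - + 1)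
  inverse a a≢0 with residue a
  ... | zero , _ , a≡0 = ⊥-elim (a≢0 (subst Null (ℤP.+-identityʳ a) a≡0))
  ... | suc j , j<q , a≡j with Coprimality.coprime-Bézout (Coprimality.prime⇒coprime q-prime j<q)
  ... | Bézout.+- x y eq =
          - + y , comb₃ (- + y) (- + 1) (- + 1) a≡j (equal⇒null (as-ℤ eq)) (ℤS.∣n⇒∣m*n (+ x) null-q)
                        (split₁ a (+ suc j) (+ x) (+ y) (+ q))
    where
    split₁ : ∀ a J X Y Q → (- Y) * a - + 1 ≡
      (- Y) * (a - J) + (- + 1) * ((+ 1 + Y * J) - X * Q) + (- + 1) * (X * Q)
    split₁ = solve-∀
    as-ℤ : 1 Nat.+ y Nat.* suc j ≡ x Nat.* q → + 1 + + y * + suc j ≡ + x * + q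
    as-ℤ e = trans (cong (λ t → + 1 + t) (sym (ℤP.pos-* y (suc j))))
               (trans (sym (ℤP.pos-+ 1 (y Nat.* suc j))) (trans (cong +_ e) (ℤP.pos-* x q)))
  ... | Bézout.-+ x y eq =
          + y , comb₃ (+ y) (- + 1) (+ 1) a≡j (equal⇒null (as-ℤ eq)) (ℤS.∣n⇒∣m*n (+ x) null-q)
                      (split₂ a (+ suc j) (+ x) (+ y) (+ q))
    where
    split₂ : ∀ a J X Y Q → Y * a - + 1 ≡
      Y * (a - J) + (- + 1) * ((+ 1 + X * Q) - Y * J) + (+ 1) * (X * Q)
    split₂ = solve-∀
    as-ℤ : 1 Nat.+ x Nat.* q ≡ y Nat.* suc j → + 1 + + x * + q ≡ + y * + suc j
    as-ℤ e = trans (cong (λ t → + 1 + t) (sym (ℤP.pos-* x q)))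
               (trans (sym (ℤP.pos-+ 1 (x Nat.* q))) (trans (cong +_ e) (ℤP.pos-* y (suc j))))

-- (2) Projective points and incidence

module Projective (q : ℕ) (q-prime : Prime q) where
  open PrimeField q q-prime

  Scaled : ℤ → Triple → Triple → Set
  Scaled c (x , y , z) (x' , y' , z') = Null (x' - c * x) × Null (y' - c * y) × Null (z' - c * z)

  samePt⇒scaled : ∀ p p' → SamePt q p p' → ∃[ c ] ¬ Null c × Scaled c p p'
  samePt⇒scaled (x , y , z) (x' , y' , z') (c , c≢0 , ex , ey , ez) =
    c , c≢0 ∘ null⇒≈0 , ℤS.∣ᵤ⇒∣ ex , ℤS.∣ᵤ⇒∣ ey , ℤS.∣ᵤ⇒∣ ez

  scaled⇒samePt : ∀ p p' c → ¬ Null c → Scaled c p p' → SamePt q p p'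
  scaled⇒samePt (x , y , z) (x' , y' , z') c c≢0 (nx , ny , nz) =
    c , c≢0 ∘ ≈0⇒null c , ℤS.∣⇒∣ᵤ nx , ℤS.∣⇒∣ᵤ ny , ℤS.∣⇒∣ᵤ nz

  samePt-refl : ∀ p → SamePt q p p
  samePt-refl p@(x , y , z) = scaled⇒samePt p p (+ 1) one≢0 (unit x , unit y , unit z)
    where
    unit : ∀ a → Null (a - + 1 * a)
    unit a = equal⇒null (sym (ℤP.*-identityˡ a))

  samePt-sym : ∀ p p' → SamePt q p p' → SamePt q p' p
  samePt-sym p@(x , y , z) p'@(x' , y' , z') s with samePt⇒scaled p p' s
  ... | c , c≢0 , nx , ny , nz with inverse c c≢0
  ... | u , uc≡1 = scaled⇒samePt p' p u u≢0 (unscale x x' nx , unscale y y' ny , unscale z z' nz)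
    where
    back : ∀ a a' c u → a - u * a' ≡ (- u) * (a' - c * a) + (- a) * (u * c - + 1)
    back = solve-∀
    unscale : ∀ a a' → Null (a' - c * a) → Null (a - u * a')
    unscale a a' n = comb₂ (- u) (- a) n uc≡1 (back a a' c u)
    one : ∀ c u → + 1 ≡ c * u + (- + 1) * (u * c - + 1)
    one = solve-∀
    u≢0 : ¬ Null u
    u≢0 nu = one≢0 (comb₂ c (- + 1) nu uc≡1 (one c u))

  samePt-trans : ∀ p p' p'' → SamePt q p p' → SamePt q p' p'' → SamePt q p p''
  samePt-trans p@(x , y , z) p'@(x' , y' , z') p''@(x'' , y'' , z'') s s'
    with samePt⇒scaled p p' s | samePt⇒scaled p' p'' s'
  ... | c , c≢0 , nx , ny , nz | d , d≢0 , nx' , ny' , nz' =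
    scaled⇒samePt p p'' (d * c) dc≢0
      (compose x x' x'' nx nx' , compose y y' y'' ny ny' , compose z z' z'' nz nz')
    where
    chain : ∀ a a' a'' c d → a'' - (d * c) * a ≡ (+ 1) * (a'' - d * a') + d * (a' - c * a)
    chain = solve-∀
    compose : ∀ a a' a'' → Null (a' - c * a) → Null (a'' - d * a') → Null (a'' - (d * c) * a)
    compose a a' a'' n n' = comb₂ (+ 1) d n' n (chain a a' a'' c d)
    dc≢0 : ¬ Null (d * c)
    dc≢0 n = Sum.[ d≢0 , c≢0 ]′ (null-product d c n)

  ≉-resp : ∀ a a' b b' → SamePt q a a' → SamePt q b b' → ¬ SamePt q a b → ¬ SamePt q a' b'
  ≉-resp a a' b b' aa' bb' a≉b a'b' =
    a≉b (samePt-trans a a' b aa' (samePt-trans a' b' b a'b' (samePt-sym b b' bb')))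

  pairing : Triple → Triple → ℤ
  pairing (l0 , l1 , l2) (x , y , z) = l0 * x + l1 * y + l2 * z

  incident⇒null : ∀ l p → Incident q l p → Null (pairing l p)
  incident⇒null (l0 , l1 , l2) (x , y , z) i = ≈0⇒null _ i

  null⇒incident : ∀ l p → Null (pairing l p) → Incident q l p
  null⇒incident (l0 , l1 , l2) (x , y , z) n = null⇒≈0 n

  line₀ : ∀ l0 l1 l2 → ¬ Null l0 → NonZero3 q (l0 , l1 , l2)
  line₀ l0 l1 l2 l0≢0 (e , _ , _) = l0≢0 (≈0⇒null l0 e)

  line₂ : ∀ l0 l1 l2 → ¬ Null l2 → NonZero3 q (l0 , l1 , l2)
  line₂ l0 l1 l2 l2≢0 (_ , _ , e) = l2≢0 (≈0⇒null l2 e)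

  incident-resp : ∀ l p p' → SamePt q p p' → Incident q l p → Incident q l p'
  incident-resp l@(l0 , l1 , l2) p@(x , y , z) p'@(x' , y' , z') s i with samePt⇒scaled p p' s
  ... | c , _ , nx , ny , nz =
    null⇒incident l p' (comb₄ l0 l1 l2 c nx ny nz (incident⇒null l p i) (expand l0 l1 l2 x y z x' y' z' c))
    where
    expand : ∀ l0 l1 l2 x y z x' y' z' c → l0 * x' + l1 * y' + l2 * z' ≡
      l0 * (x' - c * x) + l1 * (y' - c * y) + l2 * (z' - c * z) + c * (l0 * x + l1 * y + l2 * z)
    expand = solve-∀

  collinear-resp : ∀ u v w u' v' w' → SamePt q u u' → SamePt q v v' → SamePt q w w' →
    Collinear q u v w → Collinear q u' v' w'
  collinear-resp u v w u' v' w' su sv sw (l , l≢0 , iu , iv , iw) =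
    l , l≢0 , incident-resp l u u' su iu , incident-resp l v v' sv iv , incident-resp l w w' sw iw

  swap₁₂ : ∀ u v w → Collinear q u v w → Collinear q v u w
  swap₁₂ u v w (l , l≢0 , iu , iv , iw) = l , l≢0 , iv , iu , iw

  swap₂₃ : ∀ u v w → Collinear q u v w → Collinear q u w v
  swap₂₃ u v w (l , l≢0 , iu , iv , iw) = l , l≢0 , iu , iw , iv

-- (3) Points at infinity, conic points and slopes of lines

module Slopes (q : ℕ) (q-prime : Prime q) where
  open PrimeField q q-prime
  open Projective q q-prime

  P∞ : ℤ → Triple
  P∞ w = (+ 0 , + 1 , w)

  C : ℕ → Triple
  C i = (+ 1 , + i , + (i Nat.* i))

  conic-value : ∀ l0 l1 l2 i → pairing (l0 , l1 , l2) (C i) ≡ l0 + l1 * + i + l2 * (+ i * + i)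
  conic-value l0 l1 l2 i = trans
    (cong (λ s → l0 * + 1 + l1 * + i + l2 * s) (ℤP.pos-* i i))
    (cong (λ t → t + l1 * + i + l2 * (+ i * + i)) (ℤP.*-identityʳ l0))

  on-conic : ∀ l0 l1 l2 i → Incident q (l0 , l1 , l2) (C i) → Null (l0 + l1 * + i + l2 * (+ i * + i))
  on-conic l0 l1 l2 i inc =
    subst Null (conic-value l0 l1 l2 i) (incident⇒null (l0 , l1 , l2) (C i) inc)

  conic-incident : ∀ l0 l1 l2 i → Null (l0 + l1 * + i + l2 * (+ i * + i)) → Incident q (l0 , l1 , l2) (C i)
  conic-incident l0 l1 l2 i n =
    null⇒incident (l0 , l1 , l2) (C i) (subst Null (sym (conic-value l0 l1 l2 i)) n)

  slope-at-∞ : ∀ l0 l1 l2 w → Incident q (l0 , l1 , l2) (P∞ w) → Null (l1 + w * l2)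
  slope-at-∞ l0 l1 l2 w inc =
    subst Null (value l0 l1 l2 w) (incident⇒null (l0 , l1 , l2) (P∞ w) inc)
    where
    value : ∀ l0 l1 l2 w → l0 * + 0 + l1 * + 1 + l2 * w ≡ l1 + w * l2
    value = solve-∀

  -- A line through two distinct conic points C i, C j has slope i + j, since
  -- (l · C i) - (l · C j) = (i - j)(l1 + (i + j) l2).
  secant-slope : ∀ l0 l1 l2 {i j} → ¬ Null (+ i - + j) →
    Incident q (l0 , l1 , l2) (C i) → Incident q (l0 , l1 , l2) (C j) → Null (l1 + (+ i + + j) * l2)
  secant-slope l0 l1 l2 {i} {j} i≢j ci cj =
    fromInj₂ (⊥-elim ∘ i≢j) (null-product (+ i - + j) (l1 + (+ i + + j) * l2)
      (comb₂ (+ 1) (- + 1) (on-conic l0 l1 l2 i ci) (on-conic l0 l1 l2 j cj)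
        (difference l0 l1 l2 (+ i) (+ j))))
    where
    difference : ∀ l0 l1 l2 I J → (I - J) * (l1 + (I + J) * l2) ≡
      (+ 1) * (l0 + l1 * I + l2 * (I * I)) + (- + 1) * (l0 + l1 * J + l2 * (J * J))
    difference = solve-∀

  -- A line cannot have two different slopes and meet the conic: l2 = 0 since
  -- (s - t) l2 = 0, then l1 = 0, then l0 = 0 from the conic point.
  two-slopes : ∀ l0 l1 l2 s t i → ¬ Null (s - t) → Null (l1 + s * l2) → Null (l1 + t * l2) →
    Incident q (l0 , l1 , l2) (C i) → ¬ NonZero3 q (l0 , l1 , l2)
  two-slopes l0 l1 l2 s t i s≢t ns nt ci l≢0 = l≢0 (null⇒≈0 n0 , null⇒≈0 n1 , null⇒≈0 n2)
    where
    slope-difference : ∀ s t l1 l2 → (s - t) * l2 ≡ (+ 1) * (l1 + s * l2) + (- + 1) * (l1 + t * l2)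
    slope-difference = solve-∀
    first-coefficient : ∀ s l1 l2 → l1 ≡ (+ 1) * (l1 + s * l2) + (- s) * l2
    first-coefficient = solve-∀
    constant-term : ∀ I l0 l1 l2 →
      l0 ≡ (+ 1) * (l0 + l1 * I + l2 * (I * I)) + (- I) * l1 + (- (I * I)) * l2
    constant-term = solve-∀
    n2 : Null l2
    n2 = fromInj₂ (⊥-elim ∘ s≢t) (null-product (s - t) l2
           (comb₂ (+ 1) (- + 1) ns nt (slope-difference s t l1 l2)))
    n1 : Null l1
    n1 = comb₂ (+ 1) (- s) ns n2 (first-coefficient s l1 l2)
    n0 : Null l0
    n0 = comb₃ (+ 1) (- + i) (- (+ i * + i)) (on-conic l0 l1 l2 i ci) n1 n2
           (constant-term (+ i) l0 l1 l2)

  ¬collinear-∞∞C : ∀ v w i → ¬ Null (v - w) → ¬ Collinear q (P∞ v) (P∞ w) (C i)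
  ¬collinear-∞∞C v w i v≢w ((l0 , l1 , l2) , l≢0 , iv , iw , ci) =
    two-slopes l0 l1 l2 v w i v≢w (slope-at-∞ l0 l1 l2 v iv) (slope-at-∞ l0 l1 l2 w iw) ci l≢0

  ¬collinear-∞CC : ∀ w i j → ¬ Null (+ i - + j) → ¬ Null ((+ i + + j) - w) →
    ¬ Collinear q (P∞ w) (C i) (C j)
  ¬collinear-∞CC w i j i≢j ij≢w ((l0 , l1 , l2) , l≢0 , iw , ci , cj) =
    two-slopes l0 l1 l2 (+ i + + j) w i ij≢w
      (secant-slope l0 l1 l2 i≢j ci cj) (slope-at-∞ l0 l1 l2 w iw) ci l≢0

  ¬collinear-CCC : ∀ i j k → ¬ Null (+ i - + j) → ¬ Null (+ i - + k) → ¬ Null (+ j - + k) →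
    ¬ Collinear q (C i) (C j) (C k)
  ¬collinear-CCC i j k i≢j i≢k j≢k ((l0 , l1 , l2) , l≢0 , ci , cj , ck) =
    two-slopes l0 l1 l2 (+ i + + j) (+ i + + k) i (j≢k ∘ subst Null (difference (+ i) (+ j) (+ k)))
      (secant-slope l0 l1 l2 i≢j ci cj) (secant-slope l0 l1 l2 i≢k ci ck) ci l≢0
    where
    difference : ∀ I J K → (I + J) - (I + K) ≡ J - K
    difference = solve-∀

  chord-through-∞ : ∀ i j w → Null ((+ i + + j) - w) → Collinear q (P∞ w) (C i) (C j)
  chord-through-∞ i j w n =
    (+ i * + j , - w , + 1) , line₂ (+ i * + j) (- w) (+ 1) one≢0 ,
    null⇒incident (+ i * + j , - w , + 1) (P∞ w) (subst Null (sym (at-∞ (+ i) (+ j) w)) null-0) ,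
    conic-incident (+ i * + j) (- w) (+ 1) i (comb₁ (+ i) n (at-i (+ i) (+ j) w)) ,
    conic-incident (+ i * + j) (- w) (+ 1) j (comb₁ (+ j) n (at-j (+ i) (+ j) w))
    where
    at-∞ : ∀ I J w → (I * J) * + 0 + (- w) * + 1 + + 1 * w ≡ + 0
    at-∞ = solve-∀
    at-i : ∀ I J w → I * J + (- w) * I + + 1 * (I * I) ≡ I * ((I + J) - w)
    at-i = solve-∀
    at-j : ∀ I J w → I * J + (- w) * J + + 1 * (J * J) ≡ J * ((I + J) - w)
    at-j = solve-∀

  line-at-∞ : ∀ v w x y z → Null x → Collinear q (P∞ v) (P∞ w) (x , y , z)
  line-at-∞ v w x y z nx =
    (+ 1 , + 0 , + 0) , line₀ (+ 1) (+ 0) (+ 0) one≢0 ,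
    null⇒incident (+ 1 , + 0 , + 0) (P∞ v) (subst Null (sym (at-∞ v)) null-0) ,
    null⇒incident (+ 1 , + 0 , + 0) (P∞ w) (subst Null (sym (at-∞ w)) null-0) ,
    null⇒incident (+ 1 , + 0 , + 0) (x , y , z) (subst Null (sym (at-x x y z)) nx)
    where
    at-∞ : ∀ w → + 1 * + 0 + + 0 * + 1 + + 0 * w ≡ + 0
    at-∞ = solve-∀
    at-x : ∀ x y z → + 1 * x + + 0 * y + + 0 * z ≡ x
    at-x = solve-∀

  ∞≉affine : ∀ w a c → ¬ SamePt q (P∞ w) (+ 1 , a , c)
  ∞≉affine w a c s with samePt⇒scaled (P∞ w) (+ 1 , a , c) s
  ... | k , _ , n , _ , _ = one≢0 (subst Null (value k) n)
    where
    value : ∀ k → + 1 - k * + 0 ≡ + 1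
    value = solve-∀

  ∞≉C : ∀ w i → ¬ SamePt q (P∞ w) (C i)
  ∞≉C w i = ∞≉affine w (+ i) (+ (i Nat.* i))

  ∞-slope : ∀ w x y z → SamePt q (P∞ w) (x , y , z) → Null (z - w * y)
  ∞-slope w x y z s with samePt⇒scaled (P∞ w) (x , y , z) s
  ... | k , _ , _ , ny , nz = comb₂ (+ 1) (- w) nz ny (slope w y z k)
    where
    slope : ∀ w y z k → z - w * y ≡ (+ 1) * (z - k * w) + (- w) * (y - k * + 1)
    slope = solve-∀

  to-∞ : ∀ w x y z → NonZero3 q (x , y , z) → Null x → Null (z - w * y) → SamePt q (P∞ w) (x , y , z)
  to-∞ w x y z r≢0 nx nzy with null? y
  ... | yes ny =
    ⊥-elim (r≢0 (null⇒≈0 nx , null⇒≈0 ny , null⇒≈0 (comb₂ (+ 1) w nzy ny (recover-z w y z))))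
    where
    recover-z : ∀ w y z → z ≡ (+ 1) * (z - w * y) + w * y
    recover-z = solve-∀
  ... | no y≢0 = scaled⇒samePt (P∞ w) (x , y , z) y y≢0
        ( subst Null (sym (coord-x x y)) nx
        , subst Null (sym (coord-y y)) null-0
        , subst Null (coord-z w y z) nzy )
    where
    coord-x : ∀ x y → x - y * + 0 ≡ x
    coord-x = solve-∀
    coord-y : ∀ y → y - y * + 1 ≡ + 0
    coord-y = solve-∀
    coord-z : ∀ w y z → z - w * y ≡ z - y * w
    coord-z = solve-∀

  affine-coords : ∀ a c a' c' → SamePt q (+ 1 , a , c) (+ 1 , a' , c') → Null (a' - a) × Null (c' - c)
  affine-coords a c a' c' s with samePt⇒scaled (+ 1 , a , c) (+ 1 , a' , c') s
  ... | k , _ , n1 , na , nc =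
    comb₂ (+ 1) (- a) na n1 (unscaled a a' k) , comb₂ (+ 1) (- c) nc n1 (unscaled c c' k)
    where
    unscaled : ∀ a a' k → a' - a ≡ (+ 1) * (a' - k * a) + (- a) * (+ 1 - k * + 1)
    unscaled = solve-∀

  C-injective : ∀ i j → SamePt q (C i) (C j) → Null (+ j - + i)
  C-injective i j s = proj₁ (affine-coords (+ i) (+ (i Nat.* i)) (+ j) (+ (j Nat.* j)) s)

  off-conic : ∀ i a c → ¬ Null (c - a * a) → ¬ SamePt q (C i) (+ 1 , a , c)
  off-conic i a c off s with affine-coords (+ i) (+ (i Nat.* i)) a c s
  ... | na , nc = off (comb₂ (+ 1) (- (a + + i)) (subst (λ t → Null (c - t)) (ℤP.pos-* i i) nc) na
                        (square-difference a c (+ i)))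
    where
    square-difference : ∀ a c I → c - a * a ≡ (+ 1) * (c - I * I) + (- (a + I)) * (a - I)
    square-difference = solve-∀

  to-conic : ∀ a c j → Null (c - a * a) → Null (a - + j) → SamePt q (C j) (+ 1 , a , c)
  to-conic a c j on a≡j = scaled⇒samePt (C j) (+ 1 , a , c) (+ 1) one≢0
    ( null-0
    , subst Null (coord-y a (+ j)) a≡j
    , subst (λ t → Null (c - + 1 * t)) (sym (ℤP.pos-* j j))
        (comb₂ (+ 1) (a + + j) on a≡j (coord-z a c (+ j))) )
    where
    coord-y : ∀ a J → a - J ≡ a - + 1 * J
    coord-y = solve-∀
    coord-z : ∀ a c J → c - + 1 * (J * J) ≡ (+ 1) * (c - a * a) + (a + J) * (a - J)
    coord-z = solve-∀

  normalise : ∀ x y z u → ¬ Null x → Null (u * x - + 1) → SamePt q (+ 1 , u * y , u * z) (x , y , z)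
  normalise x y z u x≢0 ux≡1 = scaled⇒samePt (+ 1 , u * y , u * z) (x , y , z) x x≢0
    ( subst Null (sym (coord-x x)) null-0
    , comb₁ (- y) ux≡1 (coord-yz x y u)
    , comb₁ (- z) ux≡1 (coord-yz x z u) )
    where
    coord-x : ∀ x → x - x * + 1 ≡ + 0
    coord-x = solve-∀
    coord-yz : ∀ x y u → y - x * (u * y) ≡ (- y) * (u * x - + 1)
    coord-yz = solve-∀

-- (4) The complete arc  {A, B} ∪ {C i : i ≤ H},  A = (0,1,0), B = (0,1,b)

record Admissible (q H b : ℕ) : Set where
  field
    H-pos    : 0 < H
    H+H≤b    : H Nat.+ H ≤ b
    b≤1+H+H  : b ≤ suc (H Nat.+ H)
    b<q      : b < q
    q≤1+b+H  : q ≤ suc (b Nat.+ H)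

module CompleteArc (q : ℕ) (q-prime : Prime q) (H b : ℕ) (conditions : Admissible q H b) where
  open PrimeField q q-prime
  open Projective q q-prime
  open Slopes q q-prime
  open Admissible conditions

  A B : Triple
  A = P∞ (+ 0)
  B = P∞ (+ b)

  K : List Triple
  K = A ∷ B ∷ conicPts H

  data PointOfK : Triple → Set where
    is-A : PointOfK A
    is-B : PointOfK B
    is-C : ∀ {i} → i ≤ H → PointOfK (C i)

  classify : ∀ {p} → p ∈ K → PointOfK p
  classify (here refl) = is-A
  classify (there (here refl)) = is-B
  classify (there (there m)) with ∈P.∈-map⁻ C m
  ... | i , i∈ , refl = is-C (Nat.s≤s⁻¹ (∈P.∈-upTo⁻ i∈))

  A∈K : A ∈ K
  A∈K = here refl

  B∈K : B ∈ K
  B∈K = there (here refl)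

  C∈K : ∀ {i} → i ≤ H → C i ∈ K
  C∈K i≤H = there (there (∈P.∈-map⁺ C (∈P.∈-upTo⁺ (s≤s i≤H))))

  H+H<q : H Nat.+ H < q
  H+H<q = ℕP.≤-<-trans H+H≤b b<q

  ≤H⇒<q : ∀ {i} → i ≤ H → i < q
  ≤H⇒<q i≤H = ℕP.≤-<-trans (ℕP.≤-trans i≤H (ℕP.m≤m+n H H)) H+H<q

  b≢0 : b ≢ 0
  b≢0 b≡0 = ℕP.<⇒≱ (ℕP.<-≤-trans H-pos (ℕP.m≤m+n H H)) (subst (H Nat.+ H ≤_) b≡0 H+H≤b)

  sum<2H : ∀ {i j} → i ≤ H → j ≤ H → i ≢ j → i Nat.+ j < H Nat.+ H
  sum<2H {i} {j} i≤H j≤H i≢j with ℕP.<-cmp i j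
  ... | tri< i<j _ _ = ℕP.<-≤-trans (ℕP.+-monoˡ-< j i<j) (ℕP.+-mono-≤ j≤H j≤H)
  ... | tri≈ _ i≡j _ = contradiction i≡j i≢j
  ... | tri> _ _ j<i = ℕP.<-≤-trans (ℕP.+-monoʳ-< i j<i) (ℕP.+-mono-≤ i≤H i≤H)

  sum≢0 : ∀ {i j} → i ≢ j → i Nat.+ j ≢ 0
  sum≢0 {i} i≢j e = i≢j (trans (ℕP.m+n≡0⇒m≡0 i e) (sym (ℕP.m+n≡0⇒n≡0 i e)))

  chord-slope≢ : ∀ {i j} w → i ≤ H → j ≤ H → i ≢ j → w < q → i Nat.+ j ≢ w →
    ¬ Null ((+ i + + j) - + w)
  chord-slope≢ {i} {j} w i≤H j≤H i≢j w<q ij≢w n =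
    distinct (ℕP.<-trans (sum<2H i≤H j≤H i≢j) H+H<q) w<q ij≢w
      (subst (λ s → Null (s - + w)) (sym (ℤP.pos-+ i j)) n)

  chord-slope≢0 : ∀ {i j} → i ≤ H → j ≤ H → i ≢ j → ¬ Null ((+ i + + j) - + 0)
  chord-slope≢0 i≤H j≤H i≢j = chord-slope≢ 0 i≤H j≤H i≢j 0<q (sum≢0 i≢j)

  chord-slope≢b : ∀ {i j} → i ≤ H → j ≤ H → i ≢ j → ¬ Null ((+ i + + j) - + b)
  chord-slope≢b i≤H j≤H i≢j = chord-slope≢ b i≤H j≤H i≢j b<q
    (ℕP.<⇒≢ (ℕP.<-≤-trans (sum<2H i≤H j≤H i≢j) H+H≤b))

  param≢ : ∀ {i j} → i ≤ H → j ≤ H → i ≢ j → ¬ Null (+ i - + j)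
  param≢ i≤H j≤H = distinct (≤H⇒<q i≤H) (≤H⇒<q j≤H)

  A≉B : ¬ SamePt q A B
  A≉B s = distinct b<q 0<q b≢0 (∞-slope (+ 0) (+ 0) (+ 1) (+ b) s)

  params≢ : ∀ i j → ¬ SamePt q (C i) (C j) → i ≢ j
  params≢ i j C≉C refl = C≉C (samePt-refl (C i))

  ¬collinear-ABC : ∀ i → ¬ Collinear q A B (C i)
  ¬collinear-ABC i = ¬collinear-∞∞C (+ 0) (+ b) i (distinct 0<q b<q (b≢0 ∘ sym))

  ¬collinear-ACC : ∀ i j → i ≤ H → j ≤ H → i ≢ j → ¬ Collinear q A (C i) (C j)
  ¬collinear-ACC i j i≤H j≤H i≢j =
    ¬collinear-∞CC (+ 0) i j (param≢ i≤H j≤H i≢j) (chord-slope≢0 i≤H j≤H i≢j)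

  ¬collinear-BCC : ∀ i j → i ≤ H → j ≤ H → i ≢ j → ¬ Collinear q B (C i) (C j)
  ¬collinear-BCC i j i≤H j≤H i≢j =
    ¬collinear-∞CC (+ b) i j (param≢ i≤H j≤H i≢j) (chord-slope≢b i≤H j≤H i≢j)

  ¬collinear-CCC≤H : ∀ i j k → i ≤ H → j ≤ H → k ≤ H → i ≢ j → i ≢ k → j ≢ k →
    ¬ Collinear q (C i) (C j) (C k)
  ¬collinear-CCC≤H i j k i≤H j≤H k≤H i≢j i≢k j≢k =
    ¬collinear-CCC i j k (param≢ i≤H j≤H i≢j) (param≢ i≤H k≤H i≢k) (param≢ j≤H k≤H j≢k)

  -- No three distinct points of K are collinear: by the kinds of the three points,
  -- either two coincide or a permutation brings the triple to one of the shapes above.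
  no-three-collinear : ∀ {x y z} → PointOfK x → PointOfK y → PointOfK z →
    ¬ SamePt q x y → ¬ SamePt q x z → ¬ SamePt q y z → ¬ Collinear q x y z
  no-three-collinear is-A is-A _ x≉y _ _ _ = x≉y (samePt-refl A)
  no-three-collinear is-B is-B _ x≉y _ _ _ = x≉y (samePt-refl B)
  no-three-collinear is-A is-B is-A _ x≉z _ _ = x≉z (samePt-refl A)
  no-three-collinear is-A is-B is-B _ _ y≉z _ = y≉z (samePt-refl B)
  no-three-collinear is-A is-B (is-C {i} _) _ _ _ = ¬collinear-ABC i
  no-three-collinear is-A (is-C _) is-A _ x≉z _ _ = x≉z (samePt-refl A)
  no-three-collinear is-A (is-C {i} _) is-B _ _ _ = ¬collinear-ABC i ∘ swap₂₃ A (C i) B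
  no-three-collinear is-A (is-C {i} i≤H) (is-C {j} j≤H) _ _ y≉z =
    ¬collinear-ACC i j i≤H j≤H (params≢ i j y≉z)
  no-three-collinear is-B is-A is-A _ _ y≉z _ = y≉z (samePt-refl A)
  no-three-collinear is-B is-A is-B _ x≉z _ _ = x≉z (samePt-refl B)
  no-three-collinear is-B is-A (is-C {i} _) _ _ _ = ¬collinear-ABC i ∘ swap₁₂ B A (C i)
  no-three-collinear is-B (is-C {i} _) is-A _ _ _ =
    ¬collinear-ABC i ∘ swap₁₂ B A (C i) ∘ swap₂₃ B (C i) A
  no-three-collinear is-B (is-C _) is-B _ x≉z _ _ = x≉z (samePt-refl B)
  no-three-collinear is-B (is-C {i} i≤H) (is-C {j} j≤H) _ _ y≉z =
    ¬collinear-BCC i j i≤H j≤H (params≢ i j y≉z)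
  no-three-collinear (is-C _) is-A is-A _ _ y≉z _ = y≉z (samePt-refl A)
  no-three-collinear (is-C {i} _) is-A is-B _ _ _ =
    ¬collinear-ABC i ∘ swap₂₃ A (C i) B ∘ swap₁₂ (C i) A B
  no-three-collinear (is-C {i} i≤H) is-A (is-C {j} j≤H) _ x≉z _ =
    ¬collinear-ACC i j i≤H j≤H (params≢ i j x≉z) ∘ swap₁₂ (C i) A (C j)
  no-three-collinear (is-C {i} _) is-B is-A _ _ _ =
    ¬collinear-ABC i ∘ swap₂₃ A (C i) B ∘ swap₁₂ (C i) A B ∘ swap₂₃ (C i) B A
  no-three-collinear (is-C _) is-B is-B _ _ y≉z _ = y≉z (samePt-refl B)
  no-three-collinear (is-C {i} i≤H) is-B (is-C {j} j≤H) _ x≉z _ =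
    ¬collinear-BCC i j i≤H j≤H (params≢ i j x≉z) ∘ swap₁₂ (C i) B (C j)
  no-three-collinear (is-C {i} i≤H) (is-C {j} j≤H) is-A x≉y _ _ =
    ¬collinear-ACC i j i≤H j≤H (params≢ i j x≉y) ∘ swap₁₂ (C i) A (C j) ∘ swap₂₃ (C i) (C j) A
  no-three-collinear (is-C {i} i≤H) (is-C {j} j≤H) is-B x≉y _ _ =
    ¬collinear-BCC i j i≤H j≤H (params≢ i j x≉y) ∘ swap₁₂ (C i) B (C j) ∘ swap₂₃ (C i) (C j) B
  no-three-collinear (is-C {i} i≤H) (is-C {j} j≤H) (is-C {k} k≤H) x≉y x≉z y≉z =
    ¬collinear-CCC≤H i j k i≤H j≤H k≤H (params≢ i j x≉y) (params≢ i k x≉z) (params≢ j k y≉z)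

  K-nonzero : ∀ {p} → PointOfK p → NonZero3 q p
  K-nonzero is-A (_ , y≡0 , _) = one≢0 (≈0⇒null (+ 1) y≡0)
  K-nonzero is-B (_ , y≡0 , _) = one≢0 (≈0⇒null (+ 1) y≡0)
  K-nonzero (is-C _) (x≡0 , _ , _) = one≢0 (≈0⇒null (+ 1) x≡0)

  K-arc : IsArc q K
  K-arc = (λ p p∈K → K-nonzero (classify p∈K))
        , (λ x y z x∈K y∈K z∈K → no-three-collinear (classify x∈K) (classify y∈K) (classify z∈K))

  near≉far : ∀ i j → i ≤ H → H < j → j < q → ¬ SamePt q (C i) (C j)
  near≉far i j i≤H H<j j<q s =
    distinct j<q (≤H⇒<q i≤H) (λ e → ℕP.<⇒≱ H<j (subst (_≤ H) (sym e) i≤H)) (C-injective i j s)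

  chord-through : ∀ i j n w → i Nat.+ j ≡ n → Null (+ n - w) → Collinear q (P∞ w) (C i) (C j)
  chord-through i j n w ij≡n n≡w =
    chord-through-∞ i j w
      (subst (λ s → Null (s - w)) (trans (cong +_ (sym ij≡n)) (ℤP.pos-+ i j)) n≡w)

  module Completeness (Hq : ℕ) (Hq≤H : Hq ≤ H) (covers : Covers q Hq)
                      (T : List Triple) (T-arc : IsArc q T)
                      (K⊆T : ∀ p → InSet q K p → InSet q T p) where

    𝒫⊆K : ∀ {s} → s ∈ 𝒫 Hq → s ∈ K
    𝒫⊆K (here refl) = A∈K
    𝒫⊆K (there m) with ∈P.∈-map⁻ C m
    ... | i , i∈ , refl = C∈K (ℕP.≤-trans (Nat.s≤s⁻¹ (∈P.∈-upTo⁻ i∈)) Hq≤H)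

    -- No point of T other than u and v lies on a bisecant uv of K, as T ⊇ K is an arc.
    off-bisecants : ∀ u v s r → u ∈ K → v ∈ K → ¬ SamePt q u v → ¬ SamePt q u s → ¬ SamePt q v s →
      Collinear q u v s → r ∈ T → ¬ SamePt q s r
    off-bisecants u v s r u∈K v∈K u≉v u≉s v≉s uvs r∈T s≈r
      with K⊆T u (u , u∈K , samePt-refl u) | K⊆T v (v , v∈K , samePt-refl v)
    ... | u' , u'∈T , u'≈u | v' , v'∈T , v'≈v =
      proj₂ T-arc u' v' r u'∈T v'∈T r∈T
        (≉-resp u u' v v' u≈u' v≈v' u≉v)
        (≉-resp u u' s r u≈u' s≈r u≉s)
        (≉-resp v v' s r v≈v' s≈r v≉s)
        (collinear-resp u v s u' v' r u≈u' v≈v' s≈r uvs)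
      where
      u≈u' : SamePt q u u'
      u≈u' = samePt-sym u' u u'≈u
      v≈v' : SamePt q v v'
      v≈v' = samePt-sym v' v v'≈v

    at-infinity : ∀ x y z → (x , y , z) ∈ T → Null x → InSet q K (x , y , z)
    at-infinity x y z r∈T x≡0 with null? (z - + 0 * y) | null? (z - + b * y)
    ... | yes on-A | _ = A , A∈K , to-∞ (+ 0) x y z (proj₁ T-arc _ r∈T) x≡0 on-A
    ... | no _ | yes on-B = B , B∈K , to-∞ (+ b) x y z (proj₁ T-arc _ r∈T) x≡0 on-B
    ... | no off-A | no off-B = ⊥-elim (off-bisecants A B (x , y , z) (x , y , z) A∈K B∈K A≉B
            (off-A ∘ ∞-slope (+ 0) x y z) (off-B ∘ ∞-slope (+ b) x y z)
            (line-at-∞ (+ 0) (+ b) x y z x≡0) r∈T (samePt-refl (x , y , z)))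

    off-conic-not-in-T : ∀ a c r → ¬ Null (c - a * a) → r ∈ T → ¬ SamePt q (+ 1 , a , c) r
    off-conic-not-in-T a c r off r∈T with covers a c (off ∘ ℤS.∣ᵤ⇒∣)
    ... | s₁ , s₂ , s₁∈𝒫 , s₂∈𝒫 , s₁≉s₂ , s₁s₂r =
      off-bisecants s₁ s₂ (+ 1 , a , c) r (𝒫⊆K s₁∈𝒫) (𝒫⊆K s₂∈𝒫) s₁≉s₂
        (off-K (classify (𝒫⊆K s₁∈𝒫))) (off-K (classify (𝒫⊆K s₂∈𝒫))) s₁s₂r r∈T
      where
      off-K : ∀ {s} → PointOfK s → ¬ SamePt q s (+ 1 , a , c)
      off-K is-A = ∞≉affine (+ 0) a c
      off-K is-B = ∞≉affine (+ b) a c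
      off-K (is-C {i} _) = off-conic i a c off

    -- A conic point C j with H < j < q is on the bisecant of K through B and C (b - j)
    -- if j ≤ b, and through A and C (q - j) otherwise; hence it is not in T.
    far-conic-not-in-T : ∀ j r → H < j → j < q → r ∈ T → ¬ SamePt q (C j) r
    far-conic-not-in-T j r H<j j<q r∈T with j Nat.≤? b
    ... | yes j≤b =
      off-bisecants B (C (b ∸ j)) (C j) r B∈K (C∈K i≤H)
        (∞≉C (+ b) (b ∸ j)) (∞≉C (+ b) j) (near≉far (b ∸ j) j i≤H H<j j<q)
        (chord-through (b ∸ j) j b (+ b) (ℕP.m∸n+n≡m j≤b) (equal⇒null {+ b} refl)) r∈T
      where
      i≤H : b ∸ j ≤ H
      i≤H = subst (b ∸ j ≤_) (ℕP.m+n∸m≡n H H) (ℕP.∸-mono b≤1+H+H H<j)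
    ... | no j≰b =
      off-bisecants A (C (q ∸ j)) (C j) r A∈K (C∈K i≤H)
        (∞≉C (+ 0) (q ∸ j)) (∞≉C (+ 0) j) (near≉far (q ∸ j) j i≤H H<j j<q)
        (chord-through (q ∸ j) j q (+ 0) (ℕP.m∸n+n≡m (ℕP.<⇒≤ j<q)) (ℤS.∣m∣n⇒∣m-n null-q null-0))
        r∈T
      where
      i≤H : q ∸ j ≤ H
      i≤H = subst (q ∸ j ≤_) (ℕP.m+n∸m≡n j H)
              (ℕP.∸-monoˡ-≤ j (ℕP.≤-trans q≤1+b+H (ℕP.+-monoˡ-≤ H (ℕP.≰⇒> j≰b))))

    conic-point-in-K : ∀ j r → j < q → r ∈ T → SamePt q (C j) r → InSet q K r
    conic-point-in-K j r j<q r∈T Cj≈r with j Nat.≤? H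
    ... | yes j≤H = C j , C∈K j≤H , Cj≈r
    ... | no j≰H = ⊥-elim (far-conic-not-in-T j r (ℕP.≰⇒> j≰H) j<q r∈T Cj≈r)

    on-conic-in-K : ∀ a c r → Null (c - a * a) → r ∈ T → SamePt q (+ 1 , a , c) r → InSet q K r
    on-conic-in-K a c r on r∈T s with residue a
    ... | j , j<q , a≡j =
      conic-point-in-K j r j<q r∈T (samePt-trans (C j) (+ 1 , a , c) r (to-conic a c j on a≡j) s)

    affine-in-K : ∀ x y z → (x , y , z) ∈ T → ¬ Null x → InSet q K (x , y , z)
    affine-in-K x y z r∈T x≢0 with inverse x x≢0
    ... | u , ux≡1 with null? (u * z - u * y * (u * y))
    ...   | yes on = on-conic-in-K (u * y) (u * z) (x , y , z) on r∈T (normalise x y z u x≢0 ux≡1)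
    ...   | no off = ⊥-elim (off-conic-not-in-T (u * y) (u * z) (x , y , z) off r∈T
                               (normalise x y z u x≢0 ux≡1))

    point-of-T : ∀ r → r ∈ T → InSet q K r
    point-of-T (x , y , z) r∈T with null? x
    ... | yes x≡0 = at-infinity x y z r∈T x≡0
    ... | no x≢0 = affine-in-K x y z r∈T x≢0

    T⊆K : ∀ p → InSet q T p → InSet q K p
    T⊆K p (r , r∈T , r≈p) with point-of-T r r∈T
    ... | s , s∈K , s≈r = s , s∈K , samePt-trans s r p s≈r r≈p

  K-complete : (Hq : ℕ) → Hq ≤ H → Covers q Hq → IsCompleteArc q K
  K-complete Hq Hq≤H covers =
    K-arc , λ T T-arc K⊆T → Completeness.T⊆K Hq Hq≤H covers T T-arc K⊆T

-- (5) The parameters b_H satisfy the conditions, and the theorem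

bH-cases : ∀ Q H → (H ≡ Q / 3 × bH (suc Q) H ≡ suc (H Nat.+ H)) ⊎
                   (H ≢ Q / 3 × bH (suc Q) H ≡ H Nat.+ H)
bH-cases Q H with H Nat.≟ Q / 3
... | yes H≡ = inj₁ (H≡ , double+1 H)
  where
  double+1 : ∀ H → 2 Nat.* H Nat.+ 1 ≡ suc (H Nat.+ H)
  double+1 = ℕSolver.solve-∀
... | no H≢ = inj₂ (H≢ , double H)
  where
  double : ∀ H → 2 Nat.* H ≡ H Nat.+ H
  double = ℕSolver.solve-∀

triple : ∀ n → n Nat.* 3 ≡ n Nat.+ n Nat.+ n
triple = ℕSolver.solve-∀

thirds : ∀ Q → Q < suc (Q / 3) Nat.* 3
thirds Q = subst (_< suc (Q / 3) Nat.* 3) (sym (ℕDM.m≡m%n+[m/n]*n Q 3))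
                 (ℕP.+-monoˡ-< ((Q / 3) Nat.* 3) (ℕDM.m%n<n Q 3))

-- If Q + 1 is a prime other than 3, then Q ≤ 3⌊Q/3⌋ + 1: the remainder 2 would make
-- 3 divide Q + 1.
thirds-prime : ∀ Q → Prime (suc Q) → 3 < suc Q → Q ≤ suc ((Q / 3) Nat.* 3)
thirds-prime Q q-prime 3<q with Q Nat.% 3 | ℕDM.m%n<n Q 3 | ℕDM.m≡m%n+[m/n]*n Q 3
... | 0 | _ | Q≡ = subst (_≤ suc ((Q / 3) Nat.* 3)) (sym Q≡) (ℕP.n≤1+n _)
... | 1 | _ | Q≡ = ℕP.≤-reflexive Q≡
... | 2 | _ | Q≡ with Primality.prime⇒irreducible q-prime (ℕD.divides (suc (Q / 3)) (cong suc Q≡))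
...   | inj₁ ()
...   | inj₂ 3≡q = contradiction 3≡q (ℕP.<⇒≢ 3<q)
thirds-prime Q q-prime 3<q | suc (suc (suc _)) | s≤s (s≤s (s≤s ())) | _

positive : ∀ Q H → 18 ≤ Q → Q / 3 ≤ H → 0 < H
positive Q H 18≤Q Q/3≤H = ℕP.≤-trans (s≤s z≤n) (ℕP.≤-trans (ℕDM./-monoˡ-≤ 3 18≤Q) Q/3≤H)

twice≤ : ∀ Q H → H ≤ Q / 2 → H Nat.+ H ≤ Q
twice≤ Q H H≤Q/2 =
  ℕP.≤-trans (ℕP.+-mono-≤ H≤Q/2 H≤Q/2) (subst (_≤ Q) (double (Q / 2)) (ℕDM.m/n*n≤m Q 2))
  where
  double : ∀ n → n Nat.* 2 ≡ n Nat.+ n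
  double = ℕSolver.solve-∀

-- For q = Q + 1 prime, Q ≥ 18 and ⌊Q/3⌋ ≤ H ≤ ⌊Q/2⌋, the pair (H, b_H) is admissible:
-- if H = ⌊Q/3⌋ then b = 2H + 1 and 3H ≤ Q ≤ 3H + 1; otherwise b = 2H and Q < 3H.
admissible : ∀ Q H → Prime (suc Q) → 18 ≤ Q → Q / 3 ≤ H → H ≤ Q / 2 →
  Admissible (suc Q) H (bH (suc Q) H)
admissible Q H q-prime 18≤Q Q/3≤H H≤Q/2 with bH-cases Q H
... | inj₁ (H≡Q/3 , b≡) rewrite b≡ = record
  { H-pos = H-pos ; H+H≤b = ℕP.n≤1+n _ ; b≤1+H+H = ℕP.≤-refl
  ; b<q = s≤s (ℕP.≤-trans (ℕP.m<m+n (H Nat.+ H) H-pos) 3H≤Q)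
  ; q≤1+b+H = s≤s Q≤3H+1 }
  where
  H-pos : 0 < H
  H-pos = positive Q H 18≤Q Q/3≤H
  [Q/3]*3≡3H : (Q / 3) Nat.* 3 ≡ H Nat.+ H Nat.+ H
  [Q/3]*3≡3H = trans (cong (Nat._* 3) (sym H≡Q/3)) (triple H)
  3H≤Q : H Nat.+ H Nat.+ H ≤ Q
  3H≤Q = subst (_≤ Q) [Q/3]*3≡3H (ℕDM.m/n*n≤m Q 3)
  Q≤3H+1 : Q ≤ suc (H Nat.+ H Nat.+ H)
  Q≤3H+1 = subst (λ t → Q ≤ suc t) [Q/3]*3≡3H
             (thirds-prime Q q-prime (s≤s (ℕP.≤-trans (s≤s (s≤s (s≤s z≤n))) 18≤Q)))
... | inj₂ (H≢Q/3 , b≡) rewrite b≡ = record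
  { H-pos = positive Q H 18≤Q Q/3≤H ; H+H≤b = ℕP.≤-refl ; b≤1+H+H = ℕP.n≤1+n _
  ; b<q = s≤s (twice≤ Q H H≤Q/2)
  ; q≤1+b+H = s≤s (ℕP.<⇒≤ Q<3H) }
  where
  Q<3H : Q < H Nat.+ H Nat.+ H
  Q<3H = ℕP.<-≤-trans (thirds Q)
           (subst (suc (Q / 3) Nat.* 3 ≤_) (triple H)
             (ℕP.*-monoˡ-≤ 3 (ℕP.≤∧≢⇒< Q/3≤H (H≢Q/3 ∘ sym))))

theorem11 : (q : ℕ) → Prime q → ¬ (2 ∣ q) → 19 ≤ q →
    (Hq : ℕ) → IsHbarq q Hq → Hq ≤ (q ∸ 1) / 2 →
    (H : ℕ) → (Hq ⊔ ((q ∸ 1) / 3)) ≤ H → H ≤ (q ∸ 1) / 2 →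
    IsCompleteArc q (𝒦 q H)
theorem11 (suc Q) q-prime _ (s≤s 18≤Q) Hq (covers , _) _ H Hq⊔Q/3≤H H≤Q/2 =
  CompleteArc.K-complete (suc Q) q-prime H (bH (suc Q) H)
    (admissible Q H q-prime 18≤Q (ℕP.≤-trans (ℕP.m≤n⊔m Hq (Q / 3)) Hq⊔Q/3≤H) H≤Q/2)
    Hq (ℕP.≤-trans (ℕP.m≤m⊔n Hq (Q / 3)) Hq⊔Q/3≤H) covers
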